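{- For any (possibly empty) composition $\mathbf{A}$ of operators from $\{\mathbf{S},\mathbf{R}\}$, the map $\Phi_{\mathbf{A}}$ is a size-preserving bijection from the set of permutations sorted by $\mathbf{S}\circ\mathbf{A}$ onto the set of permutations sorted by $\mathbf{S}\circ\mathbf{R}\circ\mathbf{A}$.
   Context: Notation and conventions. - Permutations of $[n]$ are in one-line notation, with composition $(\lambda\circ\sigma)(i)=\lambda(\sigma(i))$. - A sequence of distinct integers is identified with the permutation order-isomorphic to it. - $\mathrm{Av}(231)$ (resp. $\mathrm{Av}(132)$) is the set of permutations avoiding the pattern $231$ (resp. $132$). Operators. - $\mathbf{S}$ is stack sorting: $\mathbf{S}(\varepsilon)=\varepsilon$ and $\mathbf{S}(\alpha n\beta)=\mathbf{S}(\alpha)\mathbf{S}(\beta)n$, where $n$ is the maximum entry. - $\mathbf{R}$ is reversal. - $\theta$ is sorted by an operator $\mathbf{B}$ if $\mathbf{B}(\theta)$ is the identity permutation. By Knuth, $\mathbf{S}(\sigma)$ is the identity iff $\sigma\in\mathrm{Av}(231)$. The bijection $P$ and the map $\Phi_{\mathbf{A}}$. - $\alpha\oplus\beta=\alpha(\beta+|\alpha|)$ and $\alpha\ominus\beta=(\alpha+|\beta|)\beta$. - Every nonempty $\pi\in\mathrm{Av}(231)$ is uniquely $\alpha\oplus(1\ominus\beta)$ with $\alpha,\beta\in\mathrm{Av}(231)$. - $P:\mathrm{Av}(231)\to\mathrm{Av}(132)$ is defined by $P(\varepsilon)=\varepsilon$ and $P(\alpha\oplus(1\ominus\beta))=(P(\alpha)\oplus1)\ominus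 P(\beta)$. - For $\pi\in\mathrm{Av}(231)$ of size $n$, $\lambda_\pi$ is the permutation of $[n]$ with $P(\pi)=\lambda_\pi\circ\pi$. - For $\theta$ sorted by $\mathbf{S}\circ\mathbf{A}$, $\Phi_{\mathbf{A}}(\theta)=\lambda_{\mathbf{A}(\theta)}\circ\theta$. -}

module Defs where

open import Data.Nat using (ℕ; zero; suc; _+_; _⊔_; _<?_; _≟_)
open import Data.List using (List; []; _∷_; _++_; map; length; reverse; filter; applyUpTo; foldr; [_])
open import Data.Product using (_×_; _,_; Σ; proj₁; proj₂)
open import Relation.Nullary using (yes; no)
open import Relation.Binary.PropositionalEquality using (_≡_)
open import Data.List.Relation.Binary.Permutation.Propositional using (_↭_)

-- Permutations of [n] are lists in one-line notation with values 1..n.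

idPerm : ℕ → List ℕ
idPerm n = applyUpTo suc n

IsPerm : List ℕ → Set
IsPerm θ = θ ↭ idPerm (length θ)

-- maximum entry (0 for the empty list)
maxL : List ℕ → ℕ
maxL = foldr _⊔_ 0

splitAtVal : ℕ → List ℕ → List ℕ × List ℕ
splitAtVal m [] = [] , []
splitAtVal m (x ∷ xs) with x ≟ m
... | yes _ = [] , xs
... | no _  = let r = splitAtVal m xs in (x ∷ proj₁ r) , proj₂ r

Sfuel : ℕ → List ℕ → List ℕ
Sfuel zero    _  = []
Sfuel (suc k) [] = []
Sfuel (suc k) xs@(_ ∷ _) =
  let m = maxL xs ; r = splitAtVal m xs
  in Sfuel k (proj₁ r) ++ Sfuel k (proj₂ r) ++ [ m ]

stackSort : List ℕ → List ℕ
stackSort xs = Sfuel (length xs) xs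

data Op : Set where
  S R : Op

applyOp : Op → List ℕ → List ℕ
applyOp S = stackSort
applyOp R = reverse

-- a composition o₁ ∘ o₂ ∘ ... ∘ oₖ, represented by the list (o₁ ∷ ... ∷ oₖ ∷ [])
-- (the empty list is the identity)
applyOps : List Op → List ℕ → List ℕ
applyOps []       θ = θ
applyOps (o ∷ os) θ = applyOp o (applyOps os θ)

SortedBy : List Op → List ℕ → Set
SortedBy B θ = IsPerm θ × (applyOps B θ ≡ idPerm (length θ))

-- standardization: the permutation order-isomorphic to a sequence of distinct integers
countLess : ℕ → List ℕ → ℕ
countLess x xs = length (filter (_<? x) xs)

st : List ℕ → List ℕ
st xs = map (λ x → suc (countLess x xs)) xs

_⊕_ : List ℕ → List ℕ → List ℕ
α ⊕ β = α ++ map (_+ length α) β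

_⊖_ : List ℕ → List ℕ → List ℕ
α ⊖ β = map (_+ length β) α ++ β

-- the bijection P : Av(231) → Av(132), with fuel:
-- P(α ⊕ (1 ⊖ β)) = (P(α) ⊕ 1) ⊖ P(β), where n is the maximum, α the entries
-- before it and β the entries after it (standardized).
Pfuel : ℕ → List ℕ → List ℕ
Pfuel zero    _  = []
Pfuel (suc k) [] = []
Pfuel (suc k) xs@(_ ∷ _) =
  let r = splitAtVal (maxL xs) xs
  in (Pfuel k (st (proj₁ r)) ⊕ [ 1 ]) ⊖ Pfuel k (st (proj₂ r))

P : List ℕ → List ℕ
P xs = Pfuel (length xs) xs

-- 1-indexed entry lookup (0 if out of range)
at : List ℕ → ℕ → ℕ
at []       _             = 0
at (x ∷ xs) zero          = 0
at (x ∷ xs) (suc zero)    = x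
at (x ∷ xs) (suc (suc i)) = at xs (suc i)

_∘ₚ_ : List ℕ → List ℕ → List ℕ
l ∘ₚ σ = map (at l) σ

-- 1-indexed position of the first occurrence of j (0 if absent)
indexOf : ℕ → List ℕ → ℕ
indexOf j [] = 0
indexOf j (x ∷ xs) with x ≟ j
... | yes _ = 1
... | no _  with indexOf j xs
...   | zero  = 0
...   | suc i = suc (suc i)

inv : List ℕ → List ℕ
inv π = map (λ j → indexOf j π) (idPerm (length π))

-- λ_π, the permutation with P(π) = λ_π ∘ π, i.e. λ_π = P(π) ∘ π⁻¹
lam : List ℕ → List ℕ
lam π = P π ∘ₚ inv π

Φ : List Op → List ℕ → List ℕ
Φ A θ = lam (applyOps A θ) ∘ₚ θ

-- Let π = A(θ). S sorts π exactly when π is the in-order reading of a binary tree t whose nodes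
-- are numbered in post-order, left subtrees first (postLR 0 t); P(π) is the same tree numbered
-- right subtrees first (postRL 0 t), so λ_π is the relabelling turning one numbering into the other.
-- That relabelling keeps the position of the maximum of every window (contiguous factor) of π, and
-- S and R commute with every injective relabelling of this kind, so
-- A(Φ_A(θ)) = A(λ_π ∘ θ) = λ_π ∘ π = P(π) = postRL 0 t, whose reverse postLR 0 (mirror t) is sorted
-- by S. The inverse relabelling undoes Φ_A, and t, hence the relabelling, is recovered from
-- A(Φ_A(θ)); so Φ_A is a bijection.

module Submission where

open import Defs
open import Level using (Level)
open import Data.Nat using (ℕ; zero; suc; _+_; _≤_; _<_; _≮_; z≤n; s≤s; _≟_; _<?_)
open import Data.Nat.Properties
  using ( ≤-refl; ≤-trans; ≤-antisym; ≤-reflexive; ≤-pred; <-irrefl; <-trans; <-≤-trans; ≤-<-trans; <⇒≤; <⇒≢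
        ; <-cmp; n≤1+n; n<1+n; m≤m+n; m≤n+m; m≤n⇒m≤1+n; m<n⇒m<1+n; suc-injective
        ; m≤m⊔n; m≤n⊔m; ⊔-lub; ⊔-sel; ⊔-identityʳ
        ; +-suc; +-comm; +-assoc; +-monoʳ-≤; +-monoʳ-<; +-cancelˡ-≡; +-commutativeSemigroup )
open import Algebra.Properties.CommutativeSemigroup +-commutativeSemigroup using (xy∙z≈xz∙y)
open import Data.List using (List; []; _∷_; _++_; map; length; reverse; [_]; applyUpTo)
open import Data.List.Properties
  using ( ++-assoc; ∷-injectiveˡ; ∷-injectiveʳ; length-++; length-map; length-reverse; length-applyUpTo
        ; map-++; map-∘; map-cong-local; map-id-local; reverse-++; reverse-map; reverse-involutive
        ; unfold-reverse; applyUpTo-∷ʳ; filter-accept; filter-reject )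
open import Data.List.Membership.Propositional using (_∈_; _∉_)
open import Data.List.Membership.Propositional.Properties using (∈-++⁺ʳ; ∈-applyUpTo⁻)
open import Data.List.Relation.Unary.Any using (here; there)
open import Data.List.Relation.Unary.All as All using (All; []; _∷_)
import Data.List.Relation.Unary.All.Properties as All
open import Data.List.Relation.Unary.AllPairs using ([]; _∷_)
open import Data.List.Relation.Unary.Unique.Propositional using (Unique)
import Data.List.Relation.Unary.Unique.Propositional.Properties as Unique
open import Data.List.Relation.Binary.Pointwise using (Pointwise-≡⇒≡; ≡⇒Pointwise-≡)
open import Data.List.Relation.Binary.Prefix.Heterogeneous using (Prefix; []; _∷_)
open import Data.List.Relation.Binary.Infix.Heterogeneous
  using (Infix; here; there; _++ⁱ_; _ⁱ++_; View; MkView; toView; fromView)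
import Data.List.Relation.Binary.Infix.Heterogeneous.Properties as Infix
open import Data.List.Relation.Binary.Permutation.Propositional
  using (_↭_; ↭-refl; ↭-prep; ↭-sym; ↭-trans; ↭-reflexive; ↭⇒↭ₛ; module PermutationReasoning)
open import Data.List.Relation.Binary.Permutation.Propositional.Properties
  using (All-resp-↭; ∈-resp-↭; ↭-reverse; ↭-length; ++⁺; ++⁺ˡ; ++-comm; map⁺)
import Data.List.Relation.Binary.Permutation.Setoid.Properties as Permutationₛ
open import Data.Product using (_×_; _,_; Σ; proj₁; proj₂)
open import Data.Sum using (_⊎_; inj₁; inj₂)
open import Data.Empty using (⊥-elim)
open import Function using (_∘_)
open import Relation.Nullary using (yes; no)
open import Relation.Binary.Definitions using (tri<; tri≈; tri>)
open import Relation.Binary.PropositionalEquality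
  using (_≡_; _≢_; refl; sym; trans; cong; cong₂; subst; subst₂; setoid; module ≡-Reasoning)

private
  variable
    ℓ ℓ′ : Level
    A : Set ℓ
    B : Set ℓ′

maxL-ub : ∀ xs → All (_≤ maxL xs) xs
maxL-ub []       = []
maxL-ub (x ∷ xs) =
  m≤m⊔n x (maxL xs) ∷ All.map (λ y≤ → ≤-trans y≤ (m≤n⊔m x (maxL xs))) (maxL-ub xs)

maxL-lub : ∀ {m} xs → All (_≤ m) xs → maxL xs ≤ m
maxL-lub []       []         = z≤n
maxL-lub (x ∷ xs) (x≤ ∷ xs≤) = ⊔-lub x≤ (maxL-lub xs xs≤)

maxL-∈ : ∀ x xs → maxL (x ∷ xs) ∈ x ∷ xs
maxL-∈ x []       = here (⊔-identityʳ x)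
maxL-∈ x (y ∷ ys) with ⊔-sel x (maxL (y ∷ ys))
... | inj₁ eq = here eq
... | inj₂ eq = there (subst (_∈ y ∷ ys) (sym eq) (maxL-∈ y ys))

maxL-≡ : ∀ {m xs} → m ∈ xs → All (_≤ m) xs → maxL xs ≡ m
maxL-≡ {xs = xs} m∈xs xs≤m = ≤-antisym (maxL-lub xs xs≤m) (All.lookup (maxL-ub xs) m∈xs)

maxL-↭ : ∀ {xs ys} → xs ↭ ys → maxL xs ≡ maxL ys
maxL-↭ {xs} {ys} p = ≤-antisym
  (maxL-lub xs (All-resp-↭ (↭-sym p) (maxL-ub ys)))
  (maxL-lub ys (All-resp-↭ p (maxL-ub xs)))

infix-refl : ∀ (xs : List A) → Infix _≡_ xs xs
infix-refl xs = Infix.fromPointwise (≡⇒Pointwise-≡ refl)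

All-prefix : ∀ {P : A → Set ℓ′} {w xs : List A} → Prefix _≡_ w xs → All P xs → All P w
All-prefix []         _          = []
All-prefix (refl ∷ p) (px ∷ pxs) = px ∷ All-prefix p pxs

All-infix : ∀ {P : A → Set ℓ′} {w xs : List A} → Infix _≡_ w xs → All P xs → All P w
All-infix (here p)  pxs        = All-prefix p pxs
All-infix (there i) (_ ∷ pxs)  = All-infix i pxs

prefix-split : ∀ (α : List A) {M β w} → Prefix _≡_ w (α ++ M ∷ β) → Prefix _≡_ w α ⊎ M ∈ w
prefix-split []      []         = inj₁ []
prefix-split []      (refl ∷ _) = inj₂ (here refl)
prefix-split (a ∷ α) []         = inj₁ []
prefix-split (a ∷ α) (refl ∷ p) with prefix-split α p
... | inj₁ q   = inj₁ (refl ∷ q)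
... | inj₂ M∈w = inj₂ (there M∈w)

infix-split : ∀ (α : List A) {M β w} →
  Infix _≡_ w (α ++ M ∷ β) → Infix _≡_ w α ⊎ Infix _≡_ w β ⊎ M ∈ w
infix-split []      (here [])         = inj₁ (here [])
infix-split []      (here (refl ∷ _)) = inj₂ (inj₂ (here refl))
infix-split []      (there i) = inj₂ (inj₁ i)
infix-split (a ∷ α) (here p) with prefix-split (a ∷ α) p
... | inj₁ q   = inj₁ (here q)
... | inj₂ M∈w = inj₂ (inj₂ M∈w)
infix-split (a ∷ α) (there i) with infix-split α i
... | inj₁ i′ = inj₁ (there i′)
... | inj₂ r  = inj₂ r

infix-reverse : ∀ {w xs : List A} → Infix _≡_ w xs → Infix _≡_ (reverse w) (reverse xs)
infix-reverse = reverse-view ∘ toView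
  where
  reverse-view : ∀ {w xs : List A} → View _≡_ w xs → Infix _≡_ (reverse w) (reverse xs)
  reverse-view (MkView pref {inf} w≋inf suff) with refl ← Pointwise-≡⇒≡ w≋inf =
    subst (Infix _≡_ (reverse inf)) (sym reverse-split)
      (fromView (MkView (reverse suff) (≡⇒Pointwise-≡ refl) (reverse pref)))
    where
    open ≡-Reasoning
    reverse-split : reverse (pref ++ inf ++ suff) ≡ reverse suff ++ reverse inf ++ reverse pref
    reverse-split = begin
      reverse (pref ++ inf ++ suff)             ≡⟨ reverse-++ pref (inf ++ suff) ⟩
      reverse (inf ++ suff) ++ reverse pref     ≡⟨ cong (_++ reverse pref) (reverse-++ inf suff) ⟩
      (reverse suff ++ reverse inf) ++ reverse pref ≡⟨ ++-assoc (reverse suff) _ _ ⟩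
      reverse suff ++ reverse inf ++ reverse pref ∎

++-cancel-length : ∀ (xs ys : List A) {us vs} →
  length xs ≡ length ys → xs ++ us ≡ ys ++ vs → xs ≡ ys × us ≡ vs
++-cancel-length []       []       _   eq = refl , eq
++-cancel-length (x ∷ xs) (y ∷ ys) len eq =
  let (xs≡ys , us≡vs) = ++-cancel-length xs ys (suc-injective len) (∷-injectiveʳ eq)
  in cong₂ _∷_ (∷-injectiveˡ eq) xs≡ys , us≡vs

map-++-++ : ∀ (f : A → B) xs ys zs → map f (xs ++ ys ++ zs) ≡ map f xs ++ map f ys ++ map f zs
map-++-++ f xs ys zs = trans (map-++ f xs (ys ++ zs)) (cong (map f xs ++_) (map-++ f ys zs))

reverse-++-∷ : ∀ (α : List A) M β → reverse (α ++ M ∷ β) ≡ reverse β ++ M ∷ reverse α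
reverse-++-∷ α M β = trans (reverse-++ α (M ∷ β))
  (trans (cong (_++ reverse α) (unfold-reverse M β)) (++-assoc (reverse β) [ M ] (reverse α)))

Unique-split : ∀ (α : List A) {M β} → Unique (α ++ M ∷ β) → Unique α × M ∉ α × Unique β
Unique-split []      (_ ∷ uβ)  = [] , (λ ()) , uβ
Unique-split (a ∷ α) (a∉ ∷ u) =
  let (uα , M∉α , uβ) = Unique-split α u in
  All.++⁻ˡ α a∉ ∷ uα ,
  (λ { (here M≡a)  → All.lookup a∉ (∈-++⁺ʳ α (here refl)) (sym M≡a)
      ; (there M∈α) → M∉α M∈α }) ,
  uβ

Unique-resp-↭ : ∀ {xs ys : List A} → xs ↭ ys → Unique xs → Unique ys
Unique-resp-↭ p = Permutationₛ.Unique-resp-↭ (setoid _) (↭⇒↭ₛ p)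

Unique-map : ∀ {f : A → B} {xs} →
  (∀ {x y} → x ∈ xs → y ∈ xs → x ≢ y → f x ≢ f y) → Unique xs → Unique (map f xs)
Unique-map {xs = []}     _   []        = []
Unique-map {xs = x ∷ xs} inj (x∉ ∷ u) =
  All.map⁺ (All.tabulate λ y∈ → inj (here refl) (there y∈) (All.lookup x∉ y∈))
  ∷ Unique-map (λ a∈ b∈ → inj (there a∈) (there b∈)) u

splitAtVal-first : ∀ {m} α β → m ∉ α → splitAtVal m (α ++ m ∷ β) ≡ (α , β)
splitAtVal-first {m} [] β _ with m ≟ m
... | yes _   = refl
... | no m≢m = ⊥-elim (m≢m refl)
splitAtVal-first {m} (a ∷ α) β m∉ with a ≟ m
... | yes a≡m = ⊥-elim (m∉ (here (sym a≡m)))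
... | no _ rewrite splitAtVal-first α β (m∉ ∘ there) = refl

splitAtVal-∈ : ∀ {m} xs → m ∈ xs →
  (xs ≡ proj₁ (splitAtVal m xs) ++ m ∷ proj₂ (splitAtVal m xs)) × m ∉ proj₁ (splitAtVal m xs)
splitAtVal-∈ {m} (x ∷ xs) m∈ with x ≟ m | m∈
... | yes x≡m | _          = cong (_∷ xs) x≡m , λ ()
... | no x≢m  | here m≡x  = ⊥-elim (x≢m (sym m≡x))
... | no x≢m  | there m∈′ =
  let (xs≡ , m∉) = splitAtVal-∈ xs m∈′
  in cong (x ∷_) xs≡ , λ { (here m≡x) → x≢m (sym m≡x) ; (there m∈α) → m∉ m∈α }

leftOfMax rightOfMax : List ℕ → List ℕ
leftOfMax  xs = proj₁ (splitAtVal (maxL xs) xs)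
rightOfMax xs = proj₂ (splitAtVal (maxL xs) xs)

[]≢++∷ : ∀ (α : List A) {M β} → [] ≢ α ++ M ∷ β
[]≢++∷ []      ()
[]≢++∷ (_ ∷ _) ()

record MaxSplit (xs α : List ℕ) (M : ℕ) (β : List ℕ) : Set where
  field
    split   : xs ≡ α ++ M ∷ β
    first   : M ∉ α
    bounded : All (_≤ M) xs

  M∈xs : M ∈ xs
  M∈xs = subst (M ∈_) (sym split) (∈-++⁺ʳ α (here refl))

  max≡ : maxL xs ≡ M
  max≡ = maxL-≡ M∈xs bounded

  splitAtMax≡ : splitAtVal (maxL xs) xs ≡ (α , β)
  splitAtMax≡ = trans (cong₂ splitAtVal max≡ split) (splitAtVal-first α β first)

  length≡ : length xs ≡ suc (length α + length β)
  length≡ = trans (cong length split) (trans (length-++ α) (+-suc (length α) (length β)))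

  α⊑xs : Infix _≡_ α xs
  α⊑xs = subst (Infix _≡_ α) (sym split) (infix-refl α ⁱ++ (M ∷ β))

  β⊑xs : Infix _≡_ β xs
  β⊑xs = subst (Infix _≡_ β) (sym split) (α ++ⁱ there (infix-refl β))

  length-α≤ : ∀ {k} → length xs ≤ suc k → length α ≤ k
  length-α≤ xs≤ = ≤-trans (m≤m+n _ _) (≤-pred (subst (_≤ suc _) length≡ xs≤))

  length-β≤ : ∀ {k} → length xs ≤ suc k → length β ≤ k
  length-β≤ xs≤ = ≤-trans (m≤n+m _ _) (≤-pred (subst (_≤ suc _) length≡ xs≤))

  Unique-α : Unique xs → Unique α
  Unique-α u = proj₁ (Unique-split α (subst Unique split u))

  Unique-β : Unique xs → Unique β
  Unique-β u = proj₂ (proj₂ (Unique-split α (subst Unique split u)))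

  nonempty : xs ≢ []
  nonempty xs≡[] = []≢++∷ α (trans (sym xs≡[]) split)

maxSplit : ∀ y ys → MaxSplit (y ∷ ys) (leftOfMax (y ∷ ys)) (maxL (y ∷ ys)) (rightOfMax (y ∷ ys))
maxSplit y ys = record
  { split   = proj₁ (splitAtVal-∈ (y ∷ ys) (maxL-∈ y ys))
  ; first   = proj₂ (splitAtVal-∈ (y ∷ ys) (maxL-∈ y ys))
  ; bounded = maxL-ub (y ∷ ys)
  }

module CanonicalSplit (y : ℕ) (ys : List ℕ) where
  α β : List ℕ
  α = leftOfMax (y ∷ ys)
  β = rightOfMax (y ∷ ys)

  M : ℕ
  M = maxL (y ∷ ys)

  open MaxSplit (maxSplit y ys) public

maxSplit-top : ∀ {α M β} → All (_< M) α → All (_≤ M) β → MaxSplit (α ++ M ∷ β) α M β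
maxSplit-top α<M β≤M = record
  { split   = refl
  ; first   = λ M∈α → <-irrefl refl (All.lookup α<M M∈α)
  ; bounded = All.++⁺ (All.map <⇒≤ α<M) (≤-refl ∷ β≤M)
  }

Sfuel-split : ∀ {k xs α M β} → MaxSplit xs α M β → Sfuel (suc k) xs ≡ Sfuel k α ++ Sfuel k β ++ [ M ]
Sfuel-split {xs = []}    s = ⊥-elim (MaxSplit.nonempty s refl)
Sfuel-split {k} {_ ∷ _} s =
  cong₂ (λ (α , β) M → Sfuel k α ++ Sfuel k β ++ [ M ]) (MaxSplit.splitAtMax≡ s) (MaxSplit.max≡ s)

Sfuel-↭ : ∀ k xs → length xs ≤ k → Sfuel k xs ↭ xs
Sfuel-↭ zero    []       _   = ↭-refl
Sfuel-↭ (suc k) []       _   = ↭-refl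
Sfuel-↭ (suc k) (y ∷ ys) len = begin
  Sfuel k α ++ Sfuel k β ++ [ M ]  ↭⟨ ++⁺ (Sfuel-↭ k α (length-α≤ len)) (++⁺ (Sfuel-↭ k β (length-β≤ len)) ↭-refl) ⟩
  α ++ β ++ [ M ]                  ↭⟨ ++⁺ˡ α (++-comm β [ M ]) ⟩
  α ++ M ∷ β                       ≡⟨ split ⟨
  y ∷ ys                           ∎
  where
  open PermutationReasoning
  open CanonicalSplit y ys

applyOps-↭ : ∀ A x → applyOps A x ↭ x
applyOps-↭ []      x = ↭-refl
applyOps-↭ (S ∷ A) x = ↭-trans (Sfuel-↭ _ (applyOps A x) ≤-refl) (applyOps-↭ A x)
applyOps-↭ (R ∷ A) x = ↭-trans (↭-reverse (applyOps A x)) (applyOps-↭ A x)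

-- Relabellings preserving window maxima

-- Stated pointwise so that the empty window, whose maxL is 0, imposes nothing.
record PreservesMaxima (f : ℕ → ℕ) (xs : List ℕ) : Set where
  constructor preservesMaxima
  field
    windowMax : ∀ {w} → Infix _≡_ w xs → All (λ y → f y ≤ f (maxL w)) w

open PreservesMaxima

module _ {f : ℕ → ℕ} where

  preservesMaxima-[] : PreservesMaxima f []
  preservesMaxima-[] = preservesMaxima λ { (here []) → [] }

  preservesMaxima-infix : ∀ {w xs} → Infix _≡_ w xs → PreservesMaxima f xs → PreservesMaxima f w
  preservesMaxima-infix w⊑xs pm = preservesMaxima λ v⊑w → windowMax pm (Infix.trans trans v⊑w w⊑xs)

  preservesMaxima-whole : ∀ {xs} → PreservesMaxima f xs → All (λ y → f y ≤ f (maxL xs)) xs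
  preservesMaxima-whole {xs} pm = windowMax pm (infix-refl xs)

  preservesMaxima-reverse⁻ : ∀ {xs} → PreservesMaxima f (reverse xs) → PreservesMaxima f xs
  preservesMaxima-reverse⁻ pm = preservesMaxima λ {w} w⊑xs →
    subst (λ m → All (λ y → f y ≤ f m) w) (maxL-↭ (↭-reverse w))
      (All-resp-↭ (↭-reverse w) (windowMax pm (infix-reverse w⊑xs)))

  preservesMaxima-split : ∀ {xs α M β} → MaxSplit xs α M β → All (λ y → f y ≤ f M) xs →
    PreservesMaxima f α → PreservesMaxima f β → PreservesMaxima f xs
  preservesMaxima-split {xs} {α} {M} s fxs≤fM pmα pmβ = preservesMaxima window
    where
    open MaxSplit s
    window : ∀ {w} → Infix _≡_ w xs → All (λ y → f y ≤ f (maxL w)) w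
    window {w} w⊑xs with infix-split α (subst (Infix _≡_ w) split w⊑xs)
    ... | inj₁ w⊑α        = windowMax pmα w⊑α
    ... | inj₂ (inj₁ w⊑β) = windowMax pmβ w⊑β
    ... | inj₂ (inj₂ M∈w) =
      subst (λ m → All (λ y → f y ≤ f m) w) (sym (maxL-≡ M∈w (All-infix w⊑xs bounded)))
        (All-infix w⊑xs fxs≤fM)

  maxSplit-map : ∀ {xs α M β} → Unique (map f xs) → PreservesMaxima f xs → MaxSplit xs α M β →
    MaxSplit (map f xs) (map f α) (f M) (map f β)
  maxSplit-map {xs} {α} {M} {β} u pm s = record
    { split   = fxs≡
    ; first   = proj₁ (proj₂ (Unique-split (map f α) (subst Unique fxs≡ u)))
    ; bounded = All.map⁺ (subst (λ m → All (λ z → f z ≤ f m) xs) max≡ (preservesMaxima-whole pm))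
    }
    where
    open MaxSplit s
    fxs≡ : map f xs ≡ map f α ++ f M ∷ map f β
    fxs≡ = trans (cong (map f) split) (map-++ f α (M ∷ β))

  -- Distinct values are needed because S cuts at the first occurrence of the maximum.
  Sfuel-map : ∀ k xs → Unique (map f xs) → PreservesMaxima f xs →
    Sfuel k (map f xs) ≡ map f (Sfuel k xs)
  Sfuel-map zero    _        _ _  = refl
  Sfuel-map (suc k) []       _ _  = refl
  Sfuel-map (suc k) (y ∷ ys) u pm = begin
    Sfuel (suc k) (map f (y ∷ ys))
      ≡⟨ Sfuel-split {k} fs ⟩
    Sfuel k (map f α) ++ Sfuel k (map f β) ++ [ f M ]
      ≡⟨ cong₂ (λ u v → u ++ v ++ [ f M ])
           (Sfuel-map k α (Unique-α u) (preservesMaxima-infix α⊑xs pm))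
           (Sfuel-map k β (Unique-β u) (preservesMaxima-infix β⊑xs pm)) ⟩
    map f (Sfuel k α) ++ map f (Sfuel k β) ++ [ f M ]
      ≡⟨ sym (map-++-++ f (Sfuel k α) (Sfuel k β) [ M ]) ⟩
    map f (Sfuel (suc k) (y ∷ ys))
      ∎
    where
    open ≡-Reasoning
    open CanonicalSplit y ys using (α; β; M; α⊑xs; β⊑xs)
    fs = maxSplit-map u pm (maxSplit y ys)
    open MaxSplit fs using (Unique-α; Unique-β)

  preservesMaxima-Sfuel⁻ : ∀ k xs → length xs ≤ k →
    PreservesMaxima f (Sfuel k xs) → PreservesMaxima f xs
  preservesMaxima-Sfuel⁻ zero    []       _   _  = preservesMaxima-[]
  preservesMaxima-Sfuel⁻ (suc k) []       _   _  = preservesMaxima-[]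
  preservesMaxima-Sfuel⁻ (suc k) (y ∷ ys) len pm =
    preservesMaxima-split (maxSplit y ys) fxs≤fM
      (preservesMaxima-Sfuel⁻ k α (length-α≤ len) (preservesMaxima-infix (infix-refl Sα ⁱ++ _) pm))
      (preservesMaxima-Sfuel⁻ k β (length-β≤ len) (preservesMaxima-infix (Sα ++ⁱ infix-refl Sβ ⁱ++ _) pm))
    where
    open CanonicalSplit y ys
    Sα = Sfuel k α
    Sβ = Sfuel k β
    S↭ = Sfuel-↭ (suc k) (y ∷ ys) len
    fxs≤fM : All (λ z → f z ≤ f M) (y ∷ ys)
    fxs≤fM = subst (λ m → All (λ z → f z ≤ f m) (y ∷ ys)) (trans (maxL-↭ S↭) max≡)
               (All-resp-↭ S↭ (preservesMaxima-whole pm))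

applyOps-map : ∀ A {f} x → Unique (map f x) → PreservesMaxima f (applyOps A x) →
  applyOps A (map f x) ≡ map f (applyOps A x)
applyOps-map []          x u pm = refl
applyOps-map (S ∷ A) {f} x u pm = begin
  stackSort (applyOps A (map f x))    ≡⟨ cong stackSort (applyOps-map A x u pmy) ⟩
  Sfuel (length (map f y)) (map f y)  ≡⟨ cong (λ k → Sfuel k (map f y)) (length-map f y) ⟩
  Sfuel (length y) (map f y)          ≡⟨ Sfuel-map (length y) y uy pmy ⟩
  map f (stackSort y)                 ∎
  where
  open ≡-Reasoning
  y = applyOps A x
  pmy = preservesMaxima-Sfuel⁻ (length y) y ≤-refl pm
  uy = Unique-resp-↭ (map⁺ f (↭-sym (applyOps-↭ A x))) u
applyOps-map (R ∷ A) {f} x u pm =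
  trans (cong reverse (applyOps-map A x u (preservesMaxima-reverse⁻ pm))) (sym (reverse-map f (applyOps A x)))

preservesMaxima-monotone : ∀ {f xs} → (∀ {a b} → a ≤ b → f a ≤ f b) → PreservesMaxima f xs
preservesMaxima-monotone mono = preservesMaxima λ {w} _ → All.map mono (maxL-ub w)

-- Binary trees and their post-order labellings

data Tree : Set where
  leaf : Tree
  node : Tree → Tree → Tree

size : Tree → ℕ
size leaf       = 0
size (node l r) = suc (size l + size r)

mirror : Tree → Tree
mirror leaf       = leaf
mirror (node l r) = node (mirror r) (mirror l)

size-mirror : ∀ t → size (mirror t) ≡ size t
size-mirror leaf       = refl
size-mirror (node l r) =
  cong suc (trans (cong₂ _+_ (size-mirror r) (size-mirror l)) (+-comm (size r) (size l)))

mirror-involutive : ∀ t → mirror (mirror t) ≡ t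
mirror-involutive leaf       = refl
mirror-involutive (node l r) = cong₂ node (mirror-involutive l) (mirror-involutive r)

mirror-injective : ∀ {s t} → mirror s ≡ mirror t → s ≡ t
mirror-injective {s} {t} eq =
  trans (sym (mirror-involutive s)) (trans (cong mirror eq) (mirror-involutive t))

-- The decreasing binary tree of xs, with the same fuel discipline as Sfuel and Pfuel.
shapeF : ℕ → List ℕ → Tree
shapeF zero    _            = leaf
shapeF (suc k) []           = leaf
shapeF (suc k) xs@(_ ∷ _) = node (shapeF k (leftOfMax xs)) (shapeF k (rightOfMax xs))

shapeF-split : ∀ {k xs α M β} → MaxSplit xs α M β → shapeF (suc k) xs ≡ node (shapeF k α) (shapeF k β)
shapeF-split {xs = []}    s = ⊥-elim (MaxSplit.nonempty s refl)
shapeF-split {k} {_ ∷ _} s = cong (λ (α , β) → node (shapeF k α) (shapeF k β)) (MaxSplit.splitAtMax≡ s)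

size-shapeF : ∀ k xs → length xs ≤ k → size (shapeF k xs) ≡ length xs
size-shapeF zero    []       _   = refl
size-shapeF (suc k) []       _   = refl
size-shapeF (suc k) (y ∷ ys) len = trans
  (cong₂ (λ a b → suc (a + b)) (size-shapeF k α (length-α≤ len)) (size-shapeF k β (length-β≤ len)))
  (sym length≡)
  where
  open CanonicalSplit y ys

shape : List ℕ → Tree
shape xs = shapeF (length xs) xs

idFrom : ℕ → ℕ → List ℕ
idFrom c n = applyUpTo (λ i → suc (c + i)) n

applyUpTo-+ : ∀ (f : ℕ → A) m n → applyUpTo f (m + n) ≡ applyUpTo f m ++ applyUpTo (λ i → f (m + i)) n
applyUpTo-+ f zero    n = refl
applyUpTo-+ f (suc m) n = cong (f 0 ∷_) (applyUpTo-+ (f ∘ suc) m n)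

applyUpTo-cong : ∀ {f g : ℕ → A} → (∀ i → f i ≡ g i) → ∀ n → applyUpTo f n ≡ applyUpTo g n
applyUpTo-cong f≗g zero    = refl
applyUpTo-cong f≗g (suc n) = cong₂ _∷_ (f≗g 0) (applyUpTo-cong (f≗g ∘ suc) n)

idFrom-split : ∀ c a b → idFrom c (suc (a + b)) ≡ idFrom c a ++ idFrom (c + a) b ++ [ c + suc (a + b) ]
idFrom-split c a b = begin
  idFrom c (suc (a + b))
    ≡⟨ sym (applyUpTo-∷ʳ _ (a + b)) ⟩
  idFrom c (a + b) ++ [ suc (c + (a + b)) ]
    ≡⟨ cong₂ (λ xs x → xs ++ [ x ]) (applyUpTo-+ _ a b) (sym (+-suc c (a + b))) ⟩
  (idFrom c a ++ applyUpTo (λ i → suc (c + (a + i))) b) ++ [ top ]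
    ≡⟨ ++-assoc (idFrom c a) _ _ ⟩
  idFrom c a ++ applyUpTo (λ i → suc (c + (a + i))) b ++ [ top ]
    ≡⟨ cong (λ xs → idFrom c a ++ xs ++ [ top ]) (applyUpTo-cong (λ i → cong suc (sym (+-assoc c a i))) b) ⟩
  idFrom c a ++ idFrom (c + a) b ++ [ top ]
    ∎
  where
  open ≡-Reasoning
  top = c + suc (a + b)

idFrom-bounded : ∀ c n → All (_≤ c + n) (idFrom c n)
idFrom-bounded c n = All.applyUpTo⁺₁ _ n (+-monoʳ-< c)

Unique-idFrom : ∀ c n → Unique (idFrom c n)
Unique-idFrom c n = Unique.applyUpTo⁺₁ _ n (λ i<j _ eq → <⇒≢ i<j (+-cancelˡ-≡ c _ _ (suc-injective eq)))

-- In-order readings of t with nodes numbered c+1, …, c+size t in post-order, left subtrees first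
-- (postLR) or right subtrees first (postRL). For c = 0 they range over Av(231) and Av(132).
postLR postRL : ℕ → Tree → List ℕ
postLR c leaf       = []
postLR c (node l r) = postLR c l ++ c + size (node l r) ∷ postLR (c + size l) r

postRL c leaf       = []
postRL c (node l r) = postRL (c + size r) l ++ c + size (node l r) ∷ postRL c r

postLR-↭ : ∀ c t → postLR c t ↭ idFrom c (size t)
postLR-↭ c leaf       = ↭-refl
postLR-↭ c (node l r) = begin
  postLR c l ++ top ∷ postLR (c + size l) r                ↭⟨ ++⁺ (postLR-↭ c l) (↭-prep top (postLR-↭ _ r)) ⟩
  idFrom c (size l) ++ [ top ] ++ idFrom (c + size l) (size r)
                                                           ↭⟨ ++⁺ˡ (idFrom c (size l)) (++-comm [ top ] _) ⟩
  idFrom c (size l) ++ idFrom (c + size l) (size r) ++ [ top ] ≡⟨ sym (idFrom-split c (size l) (size r)) ⟩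
  idFrom c (size (node l r))                               ∎
  where
  open PermutationReasoning
  top = c + size (node l r)

reverse-postRL : ∀ c t → reverse (postRL c t) ≡ postLR c (mirror t)
reverse-postRL c leaf       = refl
reverse-postRL c (node l r) = begin
  reverse (postRL (c + size r) l ++ top ∷ postRL c r)
    ≡⟨ reverse-++-∷ (postRL (c + size r) l) top _ ⟩
  reverse (postRL c r) ++ top ∷ reverse (postRL (c + size r) l)
    ≡⟨ cong₂ (λ xs ys → xs ++ top ∷ ys) (reverse-postRL c r) (reverse-postRL _ l) ⟩
  postLR c (mirror r) ++ top ∷ postLR (c + size r) (mirror l)
    ≡⟨ cong₂ (λ m n → postLR c (mirror r) ++ c + m ∷ postLR n (mirror l))
         (sym (size-mirror (node l r))) (cong (c +_) (sym (size-mirror r))) ⟩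
  postLR c (mirror (node l r))
    ∎
  where
  open ≡-Reasoning
  top = c + size (node l r)

reverse-postLR : ∀ c t → reverse (postLR c t) ≡ postRL c (mirror t)
reverse-postLR c t = begin
  reverse (postLR c t)                             ≡⟨ cong (reverse ∘ postLR c) (sym (mirror-involutive t)) ⟩
  reverse (postLR c (mirror (mirror t)))           ≡⟨ cong reverse (sym (reverse-postRL c (mirror t))) ⟩
  reverse (reverse (postRL c (mirror t)))          ≡⟨ reverse-involutive _ ⟩
  postRL c (mirror t)                              ∎
  where open ≡-Reasoning

postRL-↭ : ∀ c t → postRL c t ↭ idFrom c (size t)
postRL-↭ c t = begin
  postRL c t                  ↭⟨ ↭-sym (↭-reverse (postRL c t)) ⟩
  reverse (postRL c t)        ≡⟨ reverse-postRL c t ⟩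
  postLR c (mirror t)         ↭⟨ postLR-↭ c (mirror t) ⟩
  idFrom c (size (mirror t))  ≡⟨ cong (idFrom c) (size-mirror t) ⟩
  idFrom c (size t)           ∎
  where open PermutationReasoning

length-postLR : ∀ c t → length (postLR c t) ≡ size t
length-postLR c t = trans (↭-length (postLR-↭ c t)) (length-applyUpTo _ (size t))

length-postRL : ∀ c t → length (postRL c t) ≡ size t
length-postRL c t = trans (↭-length (postRL-↭ c t)) (length-applyUpTo _ (size t))

Unique-postLR : ∀ c t → Unique (postLR c t)
Unique-postLR c t = Unique-resp-↭ (↭-sym (postLR-↭ c t)) (Unique-idFrom c (size t))

Unique-postRL : ∀ c t → Unique (postRL c t)
Unique-postRL c t = Unique-resp-↭ (↭-sym (postRL-↭ c t)) (Unique-idFrom c (size t))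

IsPerm-postLR : ∀ t → IsPerm (postLR 0 t)
IsPerm-postLR t = subst (λ n → postLR 0 t ↭ idPerm n) (sym (length-postLR 0 t)) (postLR-↭ 0 t)

IsPerm-postRL : ∀ t → IsPerm (postRL 0 t)
IsPerm-postRL t = subst (λ n → postRL 0 t ↭ idPerm n) (sym (length-postRL 0 t)) (postRL-↭ 0 t)

postLR-maxSplit : ∀ c l r →
  MaxSplit (postLR c (node l r)) (postLR c l) (c + size (node l r)) (postLR (c + size l) r)
postLR-maxSplit c l r = maxSplit-top
  (All.map (λ x≤ → ≤-<-trans x≤ (+-monoʳ-< c (s≤s (m≤m+n (size l) (size r)))))
           (All-resp-↭ (↭-sym (postLR-↭ c l)) (idFrom-bounded c (size l))))
  (All.map (λ x≤ → ≤-trans x≤ (≤-trans (≤-reflexive (+-assoc c _ _)) (+-monoʳ-≤ c (n≤1+n _))))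
           (All-resp-↭ (↭-sym (postLR-↭ (c + size l) r)) (idFrom-bounded (c + size l) (size r))))

postRL-maxSplit : ∀ c l r →
  MaxSplit (postRL c (node l r)) (postRL (c + size r) l) (c + size (node l r)) (postRL c r)
postRL-maxSplit c l r = maxSplit-top
  (All.map (λ x≤ → ≤-<-trans x≤ c+r+l<top)
           (All-resp-↭ (↭-sym (postRL-↭ (c + size r) l)) (idFrom-bounded (c + size r) (size l))))
  (All.map (λ x≤ → ≤-trans x≤ (+-monoʳ-≤ c (≤-trans (m≤n+m (size r) (size l)) (n≤1+n _))))
           (All-resp-↭ (↭-sym (postRL-↭ c r)) (idFrom-bounded c (size r))))
  where
  c+r+l<top : c + size r + size l < c + size (node l r)
  c+r+l<top = subst (_< c + size (node l r))
                (trans (cong (c +_) (+-comm (size l) (size r))) (sym (+-assoc c _ _)))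
                (+-monoʳ-< c (n<1+n _))

Sfuel-postLR : ∀ k c t → size t ≤ k → Sfuel k (postLR c t) ≡ idFrom c (size t)
Sfuel-postLR zero    c leaf       _          = refl
Sfuel-postLR (suc k) c leaf       _          = refl
Sfuel-postLR (suc k) c (node l r) (s≤s size≤) = begin
  Sfuel (suc k) (postLR c (node l r))
    ≡⟨ Sfuel-split {k} (postLR-maxSplit c l r) ⟩
  Sfuel k (postLR c l) ++ Sfuel k (postLR (c + size l) r) ++ [ top ]
    ≡⟨ cong₂ (λ xs ys → xs ++ ys ++ [ top ])
         (Sfuel-postLR k c l (≤-trans (m≤m+n _ _) size≤)) (Sfuel-postLR k _ r (≤-trans (m≤n+m _ _) size≤)) ⟩
  idFrom c (size l) ++ idFrom (c + size l) (size r) ++ [ top ]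
    ≡⟨ sym (idFrom-split c (size l) (size r)) ⟩
  idFrom c (size (node l r))
    ∎
  where
  open ≡-Reasoning
  top = c + size (node l r)

stackSort-postLR : ∀ t → stackSort (postLR 0 t) ≡ idPerm (size t)
stackSort-postLR t = Sfuel-postLR (length (postLR 0 t)) 0 t (≤-reflexive (sym (length-postLR 0 t)))

Sfuel-sorted⇒postLR : ∀ k c xs → length xs ≤ k →
  Sfuel k xs ≡ idFrom c (length xs) → xs ≡ postLR c (shapeF k xs)
Sfuel-sorted⇒postLR zero    c []       _   _      = refl
Sfuel-sorted⇒postLR (suc k) c []       _   _      = refl
Sfuel-sorted⇒postLR (suc k) c (y ∷ ys) len sorted = begin
  y ∷ ys
    ≡⟨ split ⟩
  α ++ M ∷ β
    ≡⟨ cong₂ (λ xs ys → xs ++ M ∷ ys)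
         (Sfuel-sorted⇒postLR k c α (length-α≤ len) Sα≡)
         (Sfuel-sorted⇒postLR k (c + a) β (length-β≤ len) Sβ≡) ⟩
  postLR c sα ++ M ∷ postLR (c + a) sβ
    ≡⟨ cong₂ (λ m n → postLR c sα ++ m ∷ postLR (c + n) sβ)
         (trans M≡top (cong (c +_) (sym size-node))) (sym size-sα) ⟩
  postLR c (node sα sβ)
    ∎
  where
  open ≡-Reasoning
  open CanonicalSplit y ys
  a = length α
  b = length β
  sα = shapeF k α
  sβ = shapeF k β
  size-sα : size sα ≡ a
  size-sα = size-shapeF k α (length-α≤ len)
  size-node : size (node sα sβ) ≡ suc (a + b)
  size-node = cong₂ (λ m n → suc (m + n)) size-sα (size-shapeF k β (length-β≤ len))
  length-Sfuel : ∀ {c} xs → length xs ≤ k → length (Sfuel k xs) ≡ length (idFrom c (length xs))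
  length-Sfuel xs xs≤ = trans (↭-length (Sfuel-↭ k xs xs≤)) (sym (length-applyUpTo _ (length xs)))
  blocks : Sfuel k α ++ Sfuel k β ++ [ M ] ≡ idFrom c a ++ idFrom (c + a) b ++ [ c + suc (a + b) ]
  blocks = trans sorted (trans (cong (idFrom c) length≡) (idFrom-split c a b))
  cancelα = ++-cancel-length _ _ (length-Sfuel α (length-α≤ len)) blocks
  cancelβ = ++-cancel-length _ _ (length-Sfuel β (length-β≤ len)) (proj₂ cancelα)
  Sα≡ = proj₁ cancelα
  Sβ≡ = proj₁ cancelβ
  M≡top = ∷-injectiveˡ (proj₂ cancelβ)

stackSort-sorted⇒postLR : ∀ π → stackSort π ≡ idPerm (length π) → π ≡ postLR 0 (shape π)
stackSort-sorted⇒postLR π = Sfuel-sorted⇒postLR (length π) 0 π ≤-refl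

shapeF-postLR : ∀ k c t → size t ≤ k → shapeF k (postLR c t) ≡ t
shapeF-postLR zero    c leaf       _           = refl
shapeF-postLR (suc k) c leaf       _           = refl
shapeF-postLR (suc k) c (node l r) (s≤s size≤) = trans (shapeF-split {k} (postLR-maxSplit c l r))
  (cong₂ node (shapeF-postLR k c l (≤-trans (m≤m+n _ _) size≤))
              (shapeF-postLR k _ r (≤-trans (m≤n+m _ _) size≤)))

shape-postLR : ∀ c t → shape (postLR c t) ≡ t
shape-postLR c t = shapeF-postLR _ c t (≤-reflexive (sym (length-postLR c t)))

postLR-injective : ∀ {c s t} → postLR c s ≡ postLR c t → s ≡ t
postLR-injective {c} {s} {t} eq = trans (sym (shape-postLR c s)) (trans (cong shape eq) (shape-postLR c t))

postRL-injective : ∀ {c s t} → postRL c s ≡ postRL c t → s ≡ t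
postRL-injective {c} {s} {t} eq = mirror-injective (postLR-injective
  (trans (sym (reverse-postRL c s)) (trans (cong reverse eq) (reverse-postRL c t))))

preservesMaxima-postLR : ∀ {f} c d t → map f (postLR c t) ≡ postRL d t → PreservesMaxima f (postLR c t)
preservesMaxima-postLR         c d leaf       _  = preservesMaxima-[]
preservesMaxima-postLR {f} c d (node l r) eq =
  preservesMaxima-split (postLR-maxSplit c l r) fxs≤
    (preservesMaxima-postLR c _ l (proj₁ parts))
    (preservesMaxima-postLR _ d r (∷-injectiveʳ (proj₂ parts)))
  where
  top = c + size (node l r)
  parts = ++-cancel-length (map f (postLR c l)) (postRL (d + size r) l)
    (trans (length-map f (postLR c l)) (trans (length-postLR c l) (sym (length-postRL _ l))))
    (trans (sym (map-++ f (postLR c l) _)) eq)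
  fxs≤ : All (λ y → f y ≤ f top) (postLR c (node l r))
  fxs≤ = All.map⁻ (subst₂ (λ m ys → All (_≤ m) ys) (sym (∷-injectiveˡ (proj₂ parts))) (sym eq)
                     (MaxSplit.bounded (postRL-maxSplit d l r)))

preservesMaxima-postRL : ∀ {f} c d t → map f (postRL c t) ≡ postLR d t → PreservesMaxima f (postRL c t)
preservesMaxima-postRL {f} c d t eq = preservesMaxima-reverse⁻
  (subst (PreservesMaxima f) (sym (reverse-postRL c t)) (preservesMaxima-postLR c d (mirror t) eq′))
  where
  open ≡-Reasoning
  eq′ : map f (postLR c (mirror t)) ≡ postRL d (mirror t)
  eq′ = begin
    map f (postLR c (mirror t))   ≡⟨ cong (map f) (sym (reverse-postRL c t)) ⟩
    map f (reverse (postRL c t))  ≡⟨ reverse-map f (postRL c t) ⟩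
    reverse (map f (postRL c t))  ≡⟨ cong reverse eq ⟩
    reverse (postLR d t)          ≡⟨ reverse-postLR d t ⟩
    postRL d (mirror t)           ∎

-- The bijection P

shapeF-map : ∀ {f} k xs → Unique (map f xs) → PreservesMaxima f xs → shapeF k (map f xs) ≡ shapeF k xs
shapeF-map zero    _        _ _  = refl
shapeF-map (suc k) []       _ _  = refl
shapeF-map (suc k) (y ∷ ys) u pm = trans (shapeF-split {k} fs)
  (cong₂ node (shapeF-map k _ (Unique-α u) (preservesMaxima-infix α⊑xs pm))
              (shapeF-map k _ (Unique-β u) (preservesMaxima-infix β⊑xs pm)))
  where
  open CanonicalSplit y ys using (α⊑xs; β⊑xs)
  fs = maxSplit-map u pm (maxSplit y ys)
  open MaxSplit fs using (Unique-α; Unique-β)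

countLess-∷ : ∀ a w ws → (w < a × countLess a (w ∷ ws) ≡ suc (countLess a ws))
                       ⊎ (w ≮ a × countLess a (w ∷ ws) ≡ countLess a ws)
countLess-∷ a w ws with w <? a
... | yes w<a = inj₁ (w<a , cong length (filter-accept (_<? a) w<a))
... | no  w≮a = inj₂ (w≮a , cong length (filter-reject (_<? a) w≮a))

countLess-mono : ∀ {a b} xs → a ≤ b → countLess a xs ≤ countLess b xs
countLess-mono         []       _   = z≤n
countLess-mono {a} {b} (w ∷ ws) a≤b with countLess-∷ a w ws | countLess-∷ b w ws
... | inj₁ (_ , eqa)   | inj₁ (_ , eqb)    rewrite eqa | eqb = s≤s (countLess-mono ws a≤b)
... | inj₁ (w<a , _)   | inj₂ (w≮b , _)   = ⊥-elim (w≮b (<-≤-trans w<a a≤b))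
... | inj₂ (_ , eqa)   | inj₁ (_ , eqb)    rewrite eqa | eqb = m≤n⇒m≤1+n (countLess-mono ws a≤b)
... | inj₂ (_ , eqa)   | inj₂ (_ , eqb)    rewrite eqa | eqb = countLess-mono ws a≤b

countLess-< : ∀ {a b} xs → a ∈ xs → a < b → countLess a xs < countLess b xs
countLess-< {a} {b} (w ∷ ws) a∈ a<b with countLess-∷ a w ws | countLess-∷ b w ws | a∈
... | _              | inj₂ (w≮b , _) | here refl  = ⊥-elim (w≮b a<b)
... | inj₁ (w<a , _) | _              | here refl  = ⊥-elim (<-irrefl refl w<a)
... | inj₂ (_ , eqa) | inj₁ (_ , eqb) | here refl  rewrite eqa | eqb = s≤s (countLess-mono ws (<⇒≤ a<b))
... | inj₁ (_ , eqa) | inj₁ (_ , eqb) | there a∈′ rewrite eqa | eqb = s≤s (countLess-< ws a∈′ a<b)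
... | inj₁ (w<a , _) | inj₂ (w≮b , _) | there _    = ⊥-elim (w≮b (<-trans w<a a<b))
... | inj₂ (_ , eqa) | inj₁ (_ , eqb) | there a∈′ rewrite eqa | eqb = m<n⇒m<1+n (countLess-< ws a∈′ a<b)
... | inj₂ (_ , eqa) | inj₂ (_ , eqb) | there a∈′ rewrite eqa | eqb = countLess-< ws a∈′ a<b

Unique-st : ∀ {xs} → Unique xs → Unique (st xs)
Unique-st {xs} = Unique-map rank-injective
  where
  rank-injective : ∀ {a b} → a ∈ xs → b ∈ xs → a ≢ b → suc (countLess a xs) ≢ suc (countLess b xs)
  rank-injective {a} {b} a∈ b∈ a≢b eq with <-cmp a b
  ... | tri< a<b _ _ = <⇒≢ (countLess-< xs a∈ a<b) (suc-injective eq)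
  ... | tri≈ _ a≡b _ = a≢b a≡b
  ... | tri> _ _ b<a = <⇒≢ (countLess-< xs b∈ b<a) (sym (suc-injective eq))

shapeF-st : ∀ k {xs} → Unique xs → shapeF k (st xs) ≡ shapeF k xs
shapeF-st k {xs} u =
  shapeF-map k xs (Unique-st u) (preservesMaxima-monotone (λ a≤b → s≤s (countLess-mono xs a≤b)))

postRL-shift : ∀ d c t → map (_+ d) (postRL c t) ≡ postRL (c + d) t
postRL-shift d c leaf       = refl
postRL-shift d c (node l r) = begin
  map (_+ d) (postRL (c + size r) l ++ top ∷ postRL c r)
    ≡⟨ map-++ (_+ d) (postRL (c + size r) l) _ ⟩
  map (_+ d) (postRL (c + size r) l) ++ top + d ∷ map (_+ d) (postRL c r)
    ≡⟨ cong₂ (λ xs ys → xs ++ top + d ∷ ys) (postRL-shift d _ l) (postRL-shift d c r) ⟩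
  postRL (c + size r + d) l ++ top + d ∷ postRL (c + d) r
    ≡⟨ cong₂ (λ m n → postRL m l ++ n ∷ postRL (c + d) r) (xy∙z≈xz∙y c (size r) d) (xy∙z≈xz∙y c _ d) ⟩
  postRL (c + d) (node l r)
    ∎
  where
  open ≡-Reasoning
  top = c + size (node l r)

postRL-node : ∀ l r → (postRL 0 l ⊕ [ 1 ]) ⊖ postRL 0 r ≡ postRL 0 (node l r)
postRL-node l r = begin
  map (_+ length (postRL 0 r)) (postRL 0 l ++ [ suc (length (postRL 0 l)) ]) ++ postRL 0 r
      ≡⟨ cong₂ (λ m n → map (_+ m) (postRL 0 l ++ [ suc n ]) ++ postRL 0 r)
           (length-postRL 0 r) (length-postRL 0 l) ⟩
  map (_+ size r) (postRL 0 l ++ [ suc (size l) ]) ++ postRL 0 r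
      ≡⟨ cong (_++ postRL 0 r) (map-++ (_+ size r) (postRL 0 l) _) ⟩
  (map (_+ size r) (postRL 0 l) ++ [ suc (size l + size r) ]) ++ postRL 0 r
      ≡⟨ ++-assoc (map (_+ size r) (postRL 0 l)) _ _ ⟩
  map (_+ size r) (postRL 0 l) ++ suc (size l + size r) ∷ postRL 0 r
      ≡⟨ cong (λ xs → xs ++ suc (size l + size r) ∷ postRL 0 r) (postRL-shift (size r) 0 l) ⟩
  postRL 0 (node l r) ∎
  where open ≡-Reasoning

Pfuel-shapeF : ∀ k xs → Unique xs → Pfuel k xs ≡ postRL 0 (shapeF k xs)
Pfuel-shapeF zero    _        _ = refl
Pfuel-shapeF (suc k) []       _ = refl
Pfuel-shapeF (suc k) (y ∷ ys) u = begin
  (Pfuel k (st α) ⊕ [ 1 ]) ⊖ Pfuel k (st β)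
      ≡⟨ cong₂ (λ xs ys → (xs ⊕ [ 1 ]) ⊖ ys)
           (trans (Pfuel-shapeF k (st α) (Unique-st uα)) (cong (postRL 0) (shapeF-st k uα)))
           (trans (Pfuel-shapeF k (st β) (Unique-st uβ)) (cong (postRL 0) (shapeF-st k uβ))) ⟩
  (postRL 0 (shapeF k α) ⊕ [ 1 ]) ⊖ postRL 0 (shapeF k β)
      ≡⟨ postRL-node (shapeF k α) (shapeF k β) ⟩
  postRL 0 (shapeF (suc k) (y ∷ ys)) ∎
  where
  open ≡-Reasoning
  open CanonicalSplit y ys using (α; β; Unique-α; Unique-β)
  uα = Unique-α u
  uβ = Unique-β u

P-postLR : ∀ t → P (postLR 0 t) ≡ postRL 0 t
P-postLR t = trans (Pfuel-shapeF (length (postLR 0 t)) (postLR 0 t) (Unique-postLR 0 t))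
                   (cong (postRL 0) (shape-postLR 0 t))

at-map : ∀ (g : ℕ → ℕ) l i → i < length l → at (map g l) (suc i) ≡ g (at l (suc i))
at-map g (x ∷ l) zero    _         = refl
at-map g (x ∷ l) (suc i) (s≤s i<n) = at-map g l i i<n

at-applyUpTo : ∀ (f : ℕ → ℕ) n i → i < n → at (applyUpTo f n) (suc i) ≡ f i
at-applyUpTo f (suc n) zero    _         = refl
at-applyUpTo f (suc n) (suc i) (s≤s i<n) = at-applyUpTo (f ∘ suc) n i i<n

at-zero : ∀ l → at l 0 ≡ 0
at-zero []      = refl
at-zero (_ ∷ _) = refl

indexOf-head : ∀ x xs → indexOf x (x ∷ xs) ≡ 1
indexOf-head x xs with x ≟ x
... | yes _  = refl
... | no x≢x = ⊥-elim (x≢x refl)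

at-indexOf-∷ : ∀ {x y} z ρ xs → x ≢ y → at (z ∷ ρ) (indexOf y (x ∷ xs)) ≡ at ρ (indexOf y xs)
at-indexOf-∷ {x} {y} z ρ xs x≢y with x ≟ y
... | yes x≡y = ⊥-elim (x≢y x≡y)
... | no _ with indexOf y xs
...   | zero  = sym (at-zero ρ)
...   | suc i = refl

map-at-indexOf : ∀ xs ρ → Unique xs → length ρ ≡ length xs → map (λ x → at ρ (indexOf x xs)) xs ≡ ρ
map-at-indexOf []       []      _          _   = refl
map-at-indexOf (x ∷ xs) (z ∷ ρ) (x∉ ∷ u) len = cong₂ _∷_
  (cong (at (z ∷ ρ)) (indexOf-head x xs))
  (trans (map-cong-local (All.map (at-indexOf-∷ z ρ xs) x∉)) (map-at-indexOf xs ρ u (suc-injective len)))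

at-∘ₚ-inv : ∀ {x} ρ π → x ∈ idPerm (length π) → at (ρ ∘ₚ inv π) x ≡ at ρ (indexOf x π)
at-∘ₚ-inv ρ π x∈ with ∈-applyUpTo⁻ suc x∈
... | j , j<n , refl = begin
  at (map (at ρ) (inv π)) (suc j)      ≡⟨ at-map (at ρ) (inv π) j (subst (j <_) (sym length-inv) j<n) ⟩
  at ρ (at (inv π) (suc j))            ≡⟨ cong (at ρ) (at-map (λ k → indexOf k π) (idPerm n) j
                                             (subst (j <_) (sym (length-applyUpTo suc n)) j<n)) ⟩
  at ρ (indexOf (at (idPerm n) (suc j)) π) ≡⟨ cong (λ k → at ρ (indexOf k π)) (at-applyUpTo suc n j j<n) ⟩
  at ρ (indexOf (suc j) π)             ∎
  where
  open ≡-Reasoning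
  n = length π
  length-inv : length (inv π) ≡ n
  length-inv = trans (length-map _ (idPerm n)) (length-applyUpTo suc n)

Unique-IsPerm : ∀ {π} → IsPerm π → Unique π
Unique-IsPerm {π} perm = Unique-resp-↭ (↭-sym perm) (Unique-idFrom 0 (length π))

map-∘ₚ-inv : ∀ {π} ρ → IsPerm π → length ρ ≡ length π → map (at (ρ ∘ₚ inv π)) π ≡ ρ
map-∘ₚ-inv {π} ρ perm len =
  trans (map-cong-local (All.tabulate (λ x∈ → at-∘ₚ-inv ρ π (∈-resp-↭ perm x∈))))
        (map-at-indexOf π ρ (Unique-IsPerm perm) len)

IsPerm-map : ∀ {f : ℕ → ℕ} {x σ σ′} → x ↭ σ → map f σ ≡ σ′ → IsPerm σ′ → IsPerm (map f x)
IsPerm-map {f} {x} {σ} {σ′} x↭σ fσ≡σ′ σ′-perm =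
  subst (λ n → map f x ↭ idPerm n) (trans (sym (cong length fσ≡σ′)) (↭-length (map⁺ f (↭-sym x↭σ))))
    (↭-trans (map⁺ f x↭σ) (↭-trans (↭-reflexive fσ≡σ′) σ′-perm))

map-inverse : ∀ {f : A → B} {g : B → A} {x σ σ′} →
  map f σ ≡ σ′ → map g σ′ ≡ σ → x ↭ σ → map g (map f x) ≡ x
map-inverse {f = f} {g = g} {x = x} {σ = σ} fσ≡σ′ gσ′≡σ x↭σ =
  trans (sym (map-∘ {g = g} {f} x)) (map-id-local (All-resp-↭ (↭-sym x↭σ) (map-id-local⁻ σ gfσ≡σ)))
  where
  gfσ≡σ : map (g ∘ f) σ ≡ σ
  gfσ≡σ = trans (map-∘ {g = g} {f} σ) (trans (cong (map g) fσ≡σ′) gσ′≡σ)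
  map-id-local⁻ : ∀ {h : A → A} xs → map h xs ≡ xs → All (λ y → h y ≡ y) xs
  map-id-local⁻ []       _  = []
  map-id-local⁻ (y ∷ ys) eq = ∷-injectiveˡ eq ∷ map-id-local⁻ ys (∷-injectiveʳ eq)

module Relabel (t : Tree) where

  fwd bwd : ℕ → ℕ
  fwd = at (lam (postLR 0 t))
  bwd = at (postLR 0 t ∘ₚ inv (postRL 0 t))

  map-fwd : map fwd (postLR 0 t) ≡ postRL 0 t
  map-fwd = trans
    (map-∘ₚ-inv (P (postLR 0 t)) (IsPerm-postLR t)
      (trans (cong length (P-postLR t)) (trans (length-postRL 0 t) (sym (length-postLR 0 t)))))
    (P-postLR t)

  map-bwd : map bwd (postRL 0 t) ≡ postLR 0 t
  map-bwd = map-∘ₚ-inv (postLR 0 t) (IsPerm-postRL t) (trans (length-postLR 0 t) (sym (length-postRL 0 t)))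

  preservesMaxima-fwd : PreservesMaxima fwd (postLR 0 t)
  preservesMaxima-fwd = preservesMaxima-postLR 0 0 t map-fwd

  preservesMaxima-bwd : PreservesMaxima bwd (postRL 0 t)
  preservesMaxima-bwd = preservesMaxima-postRL 0 0 t map-bwd

-- Permutations sorted by S ∘ A and by S ∘ R ∘ A

module _ (A : List Op) where

  record SortedLR (t : Tree) (θ : List ℕ) : Set where
    constructor _,_
    field
      isPerm : IsPerm θ
      image  : applyOps A θ ≡ postLR 0 t

  record SortedRL (t : Tree) (τ : List ℕ) : Set where
    constructor _,_
    field
      isPerm : IsPerm τ
      image  : applyOps A τ ≡ postRL 0 t

  private
    length-applyOps : ∀ x → length (applyOps A x) ≡ length x
    length-applyOps x = ↭-length (applyOps-↭ A x)

    ↭-applyOps : ∀ {x σ} → applyOps A x ≡ σ → x ↭ σ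
    ↭-applyOps {x} eq = ↭-trans (↭-sym (applyOps-↭ A x)) (↭-reflexive eq)

  SortedBy⇒SortedLR : ∀ {θ} → SortedBy (S ∷ A) θ → SortedLR (shape (applyOps A θ)) θ
  SortedBy⇒SortedLR {θ} (perm , sorted) =
    perm , stackSort-sorted⇒postLR (applyOps A θ) (trans sorted (cong idPerm (sym (length-applyOps θ))))

  SortedLR⇒SortedBy : ∀ {t θ} → SortedLR t θ → SortedBy (S ∷ A) θ
  SortedLR⇒SortedBy {t} {θ} (perm , eq) = perm , (begin
    stackSort (applyOps A θ)  ≡⟨ cong stackSort eq ⟩
    stackSort (postLR 0 t)    ≡⟨ stackSort-postLR t ⟩
    idPerm (size t)           ≡⟨ cong idPerm size≡ ⟩
    idPerm (length θ)         ∎)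
    where
    open ≡-Reasoning
    size≡ : size t ≡ length θ
    size≡ = sym (trans (sym (length-applyOps θ)) (trans (cong length eq) (length-postLR 0 t)))

  SortedBy⇒SortedRL : ∀ {τ} → SortedBy (S ∷ R ∷ A) τ → SortedRL (mirror (shape (reverse (applyOps A τ)))) τ
  SortedBy⇒SortedRL {τ} (perm , sorted) = perm , (begin
    ρ                                       ≡⟨ sym (reverse-involutive ρ) ⟩
    reverse (reverse ρ)                     ≡⟨ cong reverse (stackSort-sorted⇒postLR (reverse ρ) sorted′) ⟩
    reverse (postLR 0 (shape (reverse ρ)))  ≡⟨ reverse-postLR 0 (shape (reverse ρ)) ⟩
    postRL 0 (mirror (shape (reverse ρ)))   ∎)
    where
    open ≡-Reasoning
    ρ = applyOps A τ
    sorted′ : stackSort (reverse ρ) ≡ idPerm (length (reverse ρ))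
    sorted′ = trans sorted (cong idPerm (sym (trans (length-reverse ρ) (length-applyOps τ))))

  SortedRL⇒SortedBy : ∀ {t τ} → SortedRL t τ → SortedBy (S ∷ R ∷ A) τ
  SortedRL⇒SortedBy {t} {τ} (perm , eq) = perm , (begin
    stackSort (reverse (applyOps A τ))  ≡⟨ cong (stackSort ∘ reverse) eq ⟩
    stackSort (reverse (postRL 0 t))    ≡⟨ cong stackSort (reverse-postRL 0 t) ⟩
    stackSort (postLR 0 (mirror t))     ≡⟨ stackSort-postLR (mirror t) ⟩
    idPerm (size (mirror t))            ≡⟨ cong idPerm (trans (size-mirror t) size≡) ⟩
    idPerm (length τ)                   ∎)
    where
    open ≡-Reasoning
    size≡ : size t ≡ length τ
    size≡ = sym (trans (sym (length-applyOps τ)) (trans (cong length eq) (length-postRL 0 t)))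

  applyOps-relabel : ∀ {f x σ} → applyOps A x ≡ σ → Unique (map f σ) → PreservesMaxima f σ →
    applyOps A (map f x) ≡ map f σ
  applyOps-relabel {f} {x} eq u pm = trans
    (applyOps-map A x (Unique-resp-↭ (map⁺ f (↭-sym (↭-applyOps eq))) u)
                      (subst (PreservesMaxima f) (sym eq) pm))
    (cong (map f) eq)

  module _ {t : Tree} where
    open Relabel t

    Φ≡map-fwd : ∀ {θ} → SortedLR t θ → Φ A θ ≡ map fwd θ
    Φ≡map-fwd {θ} (_ , eq) = cong (λ π → map (at (lam π)) θ) eq

    SortedLR-Φ : ∀ {θ} → SortedLR t θ → SortedRL t (Φ A θ)
    SortedLR-Φ s@(_ , eq) = subst (SortedRL t) (sym (Φ≡map-fwd s))
      ( IsPerm-map (↭-applyOps eq) map-fwd (IsPerm-postRL t)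
      , trans (applyOps-relabel eq (subst Unique (sym map-fwd) (Unique-postRL 0 t)) preservesMaxima-fwd)
              map-fwd )

    SortedRL-bwd : ∀ {τ} → SortedRL t τ → SortedLR t (map bwd τ)
    SortedRL-bwd (_ , eq) =
      ( IsPerm-map (↭-applyOps eq) map-bwd (IsPerm-postLR t)
      , trans (applyOps-relabel eq (subst Unique (sym map-bwd) (Unique-postLR 0 t)) preservesMaxima-bwd)
              map-bwd )

    bwd-Φ : ∀ {θ} → SortedLR t θ → map bwd (Φ A θ) ≡ θ
    bwd-Φ s@(_ , eq) = trans (cong (map bwd) (Φ≡map-fwd s)) (map-inverse map-fwd map-bwd (↭-applyOps eq))

    Φ-bwd : ∀ {τ} → SortedRL t τ → Φ A (map bwd τ) ≡ τ
    Φ-bwd r@(_ , eq) = trans (Φ≡map-fwd (SortedRL-bwd r)) (map-inverse map-bwd map-fwd (↭-applyOps eq))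

    Φ-surjective : ∀ {τ} → SortedRL t τ → Σ (List ℕ) (λ θ → SortedLR t θ × Φ A θ ≡ τ)
    Φ-surjective {τ} r = map bwd τ , SortedRL-bwd r , Φ-bwd r

  Φ-injective : ∀ {t₁ t₂ θ₁ θ₂} → SortedLR t₁ θ₁ → SortedLR t₂ θ₂ → Φ A θ₁ ≡ Φ A θ₂ → θ₁ ≡ θ₂
  Φ-injective {t₁} {t₂} {θ₁} {θ₂} s₁ s₂ Φ≡ = begin
    θ₁                             ≡⟨ sym (bwd-Φ s₁) ⟩
    map (Relabel.bwd t₁) (Φ A θ₁)  ≡⟨ cong₂ (λ t τ → map (Relabel.bwd t) τ) t₁≡t₂ Φ≡ ⟩
    map (Relabel.bwd t₂) (Φ A θ₂)  ≡⟨ bwd-Φ s₂ ⟩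
    θ₂                             ∎
    where
    open ≡-Reasoning
    t₁≡t₂ : t₁ ≡ t₂
    t₁≡t₂ = postRL-injective (trans (sym (SortedRL.image (SortedLR-Φ s₁)))
                               (trans (cong (applyOps A) Φ≡) (SortedRL.image (SortedLR-Φ s₂))))

corollary4p9 : (A : List Op) →
    ((θ : List ℕ) → SortedBy (S ∷ A) θ →
        SortedBy (S ∷ R ∷ A) (Φ A θ) × (length (Φ A θ) ≡ length θ))
    × ((θ₁ θ₂ : List ℕ) → SortedBy (S ∷ A) θ₁ → SortedBy (S ∷ A) θ₂ →
        Φ A θ₁ ≡ Φ A θ₂ → θ₁ ≡ θ₂)
    × ((τ : List ℕ) → SortedBy (S ∷ R ∷ A) τ →
        Σ (List ℕ) (λ θ → SortedBy (S ∷ A) θ × (Φ A θ ≡ τ)))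
corollary4p9 A =
    (λ θ sθ → SortedRL⇒SortedBy A (SortedLR-Φ A (SortedBy⇒SortedLR A sθ)) , length-map _ θ)
  , (λ θ₁ θ₂ sθ₁ sθ₂ → Φ-injective A (SortedBy⇒SortedLR A sθ₁) (SortedBy⇒SortedLR A sθ₂))
  , (λ τ sτ → let (θ , sθ , Φθ≡τ) = Φ-surjective A (SortedBy⇒SortedRL A sτ)
              in θ , SortedLR⇒SortedBy A sθ , Φθ≡τ)
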